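{- Let $q$ be an odd prime. Then for every integer $h$ with $1\leq h<q-1$, the integer $\frac{2^{q(q-1)}-1}{q}-h$ does not lie in the image of $Z_{2^q}:\mathbb{N}\to\mathbb{N}$.
   Context: For an integer $b\geq 2$, $Z_b(m)$ denotes the number of trailing zeroes in the base $b$ expansion of $m!$. -}

module Defs where

open import Data.Nat using (ℕ; suc; _^_; _!)
open import Data.Nat.Divisibility using (_∣_)
open import Data.Product using (_×_; ∃)
open import Relation.Nullary using (¬_)

-- Z b m ≡ k  (the number of trailing zeroes of m! in base b is k)
-- means: b^k divides m! but b^(k+1) does not.
-- (For b ≥ 2 this k exists and is unique, since m! ≠ 0.)
TrailingZeros : ℕ → ℕ → ℕ → Set
TrailingZeros b m k = (b ^ k ∣ m !) × ¬ (b ^ suc k ∣ m !)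

InImageZ : ℕ → ℕ → Set
InImageZ b n = ∃ λ m → TrailingZeros b m n

{-# OPTIONS --safe #-}
-- Z_{2^q}(m) = ⌊v₂(m!)/q⌋ is monotone in m. Since v₂((2ⁿ)!) = 2ⁿ − 1 and 2ⁿ contributes n
-- factors of 2, Z_{2^q} jumps at m = 2ⁿ from ⌊(2ⁿ−1−n)/q⌋ to ⌊(2ⁿ−1)/q⌋, missing every k
-- with q(k+1) < 2ⁿ ≤ n + qk. For n = q(q−1) and N = ⌊(2ⁿ−1)/q⌋ this holds for k = N − h
-- whenever 1 ≤ h < q − 1.
module Submission where

open import Defs
open import Data.Nat using (ℕ; zero; suc; _+_; _*_; _∸_; _^_; _≤_; _<_; _!; z≤n; s≤s; NonZero; >-nonZero)
open import Data.Nat.Properties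
open import Data.Nat.DivMod using (_/_; _%_; m≡m%n+[m/n]*n; m%n<n; m/n*n≤m; n/n≡1; /-monoˡ-≤)
open import Data.Nat.Primality using (Prime; prime⇒nonZero; prime[2]; euclidsLemma)
open import Data.Nat.Divisibility
  using (_∣_; divides; ∣-trans; ∣1⇒≡1; ∣m+n∣m⇒∣n; m∣m*n; *-monoʳ-∣; *-cancelˡ-∣; ∣-reflexive; m≤n⇒m!∣n!)
open import Data.Product using (_×_; _,_; ∃-syntax)
open import Data.Sum using (inj₁; inj₂)
open import Relation.Nullary using (¬_; yes; no; contradiction)
open import Relation.Binary.PropositionalEquality using (_≡_; refl; sym; cong; subst; module ≡-Reasoning)
open import Data.Nat.Solver using (module +-*-Solver)

Odd : ℕ → Set
Odd n = ¬ (2 ∣ n)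

odd-* : ∀ {m n} → Odd m → Odd n → Odd (m * n)
odd-* {m} {n} odd-m odd-n 2∣mn with euclidsLemma m n prime[2] 2∣mn
... | inj₁ 2∣m = odd-m 2∣m
... | inj₂ 2∣n = odd-n 2∣n

odd-1+2* : ∀ n → Odd (suc (2 * n))
odd-1+2* n 2∣1+2n with ∣1⇒≡1 (∣m+n∣m⇒∣n (subst (2 ∣_) (+-comm 1 (2 * n)) 2∣1+2n) (m∣m*n n))
... | ()

^-monoʳ-∣ : ∀ m {n o} → n ≤ o → m ^ n ∣ m ^ o
^-monoʳ-∣ m {n} {o} n≤o = divides (m ^ (o ∸ n)) (begin
  m ^ o                  ≡⟨ cong (m ^_) (m+[n∸m]≡n n≤o) ⟨
  m ^ (n + (o ∸ n))      ≡⟨ ^-distribˡ-+-* m n (o ∸ n) ⟩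
  m ^ n * m ^ (o ∸ n)    ≡⟨ *-comm (m ^ n) _ ⟩
  m ^ (o ∸ n) * m ^ n    ∎)
  where open ≡-Reasoning

2^m∣2^n*odd⇒m≤n : ∀ {m n u} → Odd u → 2 ^ m ∣ 2 ^ n * u → m ≤ n
2^m∣2^n*odd⇒m≤n {m} {n} {u} odd-u 2^m∣2^nu with m ≤? n
... | yes m≤n = m≤n
... | no m≰n = contradiction 2∣u odd-u
  where
  2^n*2∣2^n*u : 2 ^ n * 2 ∣ 2 ^ n * u
  2^n*2∣2^n*u = ∣-trans (∣-reflexive (*-comm (2 ^ n) 2)) (∣-trans (^-monoʳ-∣ 2 (≰⇒> m≰n)) 2^m∣2^nu)

  2∣u : 2 ∣ u
  2∣u = *-cancelˡ-∣ (2 ^ n) {{m^n≢0 2 n}} 2^n*2∣2^n*u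

n!≡n*[n∸1]! : ∀ {n} → 0 < n → n ! ≡ n * (n ∸ 1) !
n!≡n*[n∸1]! {suc n} _ = refl

[2*n]!≡2^n*n!*odd : ∀ n → ∃[ u ] Odd u × (2 * n) ! ≡ 2 ^ n * n ! * u
[2*n]!≡2^n*n!*odd zero = 1 , odd-1+2* 0 , refl
[2*n]!≡2^n*n!*odd (suc n) with [2*n]!≡2^n*n!*odd n
... | u , odd-u , eq = suc (2 * n) * u , odd-* (odd-1+2* n) odd-u , (begin
  (2 * suc n) !                                   ≡⟨ cong _! (*-suc 2 n) ⟩
  (2 + 2 * n) !                                   ≡⟨⟩
  (2 + 2 * n) * (suc (2 * n) * (2 * n) !)         ≡⟨ cong (λ x → (2 + 2 * n) * (suc (2 * n) * x)) eq ⟩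
  (2 + 2 * n) * (suc (2 * n) * (2 ^ n * n ! * u)) ≡⟨ regroup n (2 ^ n) (n !) u ⟩
  2 ^ suc n * suc n ! * (suc (2 * n) * u)         ∎)
  where
  open ≡-Reasoning
  open +-*-Solver
  regroup : ∀ n a b u → (2 + 2 * n) * (suc (2 * n) * (a * b * u)) ≡ 2 * a * ((1 + n) * b) * ((1 + 2 * n) * u)
  regroup = solve 4 (λ n a b u → (con 2 :+ con 2 :* n) :* ((con 1 :+ con 2 :* n) :* (a :* b :* u))
                              := con 2 :* a :* ((con 1 :+ n) :* b) :* ((con 1 :+ con 2 :* n) :* u)) refl

-- v₂((2ⁿ)!) = 2ⁿ − 1, written with the factor 2 moved to the left so that no subtraction occurs.
2*[2^n]!≡2^2^n*odd : ∀ n → ∃[ u ] Odd u × 2 * (2 ^ n) ! ≡ 2 ^ (2 ^ n) * u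
2*[2^n]!≡2^2^n*odd zero = 1 , odd-1+2* 0 , refl
2*[2^n]!≡2^2^n*odd (suc n) with 2*[2^n]!≡2^2^n*odd n | [2*n]!≡2^n*n!*odd (2 ^ n)
... | u , odd-u , eq | v , odd-v , eq′ = u * v , odd-* odd-u odd-v , (begin
  2 * (2 * T) !              ≡⟨ cong (2 *_) eq′ ⟩
  2 * (2 ^ T * T ! * v)      ≡⟨ solve 3 (λ a f v → con 2 :* (a :* f :* v) := a :* (con 2 :* f) :* v) refl (2 ^ T) (T !) v ⟩
  2 ^ T * (2 * T !) * v      ≡⟨ cong (λ x → 2 ^ T * x * v) eq ⟩
  2 ^ T * (2 ^ T * u) * v    ≡⟨ solve 3 (λ a u v → a :* (a :* u) :* v := a :* a :* (u :* v)) refl (2 ^ T) u v ⟩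
  2 ^ T * 2 ^ T * (u * v)    ≡⟨ cong (_* (u * v)) (^-distribˡ-+-* 2 T T) ⟨
  2 ^ (T + T) * (u * v)      ≡⟨ cong (λ x → 2 ^ (T + x) * (u * v)) (+-identityʳ T) ⟨
  2 ^ (2 * T) * (u * v)      ∎)
  where
  T = 2 ^ n
  open ≡-Reasoning
  open +-*-Solver

n<2^n : ∀ n → n < 2 ^ n
n<2^n zero = s≤s z≤n
n<2^n (suc n) = +-mono-≤-< (m^n>0 2 n) (subst (n <_) (sym (+-identityʳ (2 ^ n))) (n<2^n n))

q[1+k]<2^n≤n+qk⇒¬InImageZ : ∀ q n k → q * suc k < 2 ^ n → 2 ^ n ≤ n + q * k → ¬ InImageZ (2 ^ q) k
q[1+k]<2^n≤n+qk⇒¬InImageZ q n k below above (m , 2^qk∣m! , 2^q[1+k]∤m!)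
  with 2*[2^n]!≡2^2^n*odd n | 2 ^ n ≤? m
... | u , odd-u , eq | yes 2^n≤m = 2^q[1+k]∤m! (*-cancelˡ-∣ 2 2*2^q[1+k]∣2*m!)
  where
  2*2^q[1+k]∣2*m! : 2 * (2 ^ q) ^ suc k ∣ 2 * m !
  2*2^q[1+k]∣2*m! = begin
    2 * (2 ^ q) ^ suc k     ≡⟨ cong (2 *_) (^-*-assoc 2 q (suc k)) ⟩
    2 ^ suc (q * suc k)     ∣⟨ ^-monoʳ-∣ 2 below ⟩
    2 ^ (2 ^ n)             ∣⟨ m∣m*n u ⟩
    2 ^ (2 ^ n) * u         ≡⟨ eq ⟨
    2 * (2 ^ n) !           ∣⟨ *-monoʳ-∣ 2 (m≤n⇒m!∣n! 2^n≤m) ⟩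
    2 * m !                 ∎
    where open Data.Nat.Divisibility.∣-Reasoning
... | u , odd-u , eq | no 2^n≰m = <⇒≱ (s≤s above) (2^m∣2^n*odd⇒m≤n odd-u 2^[1+n+qk]∣2^2^n*u)
  where
  m≤2^n∸1 : m ≤ 2 ^ n ∸ 1
  m≤2^n∸1 = ∸-monoˡ-≤ 1 (≰⇒> 2^n≰m)

  2^[1+n+qk]∣2^2^n*u : 2 ^ suc (n + q * k) ∣ 2 ^ (2 ^ n) * u
  2^[1+n+qk]∣2^2^n*u = begin
    2 ^ suc (n + q * k)                ≡⟨ cong (2 *_) (^-distribˡ-+-* 2 n (q * k)) ⟩
    2 * (2 ^ n * 2 ^ (q * k))          ≡⟨ cong (λ x → 2 * (2 ^ n * x)) (^-*-assoc 2 q k) ⟨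
    2 * (2 ^ n * (2 ^ q) ^ k)          ∣⟨ *-monoʳ-∣ 2 (*-monoʳ-∣ (2 ^ n) (∣-trans 2^qk∣m! (m≤n⇒m!∣n! m≤2^n∸1))) ⟩
    2 * (2 ^ n * (2 ^ n ∸ 1) !)        ≡⟨ cong (2 *_) (n!≡n*[n∸1]! (m^n>0 2 n)) ⟨
    2 * (2 ^ n) !                      ≡⟨ eq ⟩
    2 ^ (2 ^ n) * u                    ∎
    where open Data.Nat.Divisibility.∣-Reasoning

q*[1+m/q∸h]≤m : ∀ m q .{{_ : NonZero q}} h → 1 ≤ h → q ≤ m → q * suc (m / q ∸ h) ≤ m
q*[1+m/q∸h]≤m m q h 1≤h q≤m = begin
  q * suc (m / q ∸ h)    ≤⟨ *-monoʳ-≤ q (≤-trans (s≤s (∸-monoʳ-≤ (m / q) 1≤h)) (≤-reflexive (m+[n∸m]≡n 1≤m/q))) ⟩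
  q * (m / q)            ≡⟨ *-comm q (m / q) ⟩
  m / q * q              ≤⟨ m/n*n≤m m q ⟩
  m                      ∎
  where
  open ≤-Reasoning
  1≤m/q : 1 ≤ m / q
  1≤m/q = subst (_≤ m / q) (n/n≡1 q) (/-monoˡ-≤ q q≤m)

m<q*[1+h]+q*[m/q∸h] : ∀ m q .{{_ : NonZero q}} h → m < q * suc h + q * (m / q ∸ h)
m<q*[1+h]+q*[m/q∸h] m q h = begin-strict
  m                                ≡⟨ m≡m%n+[m/n]*n m q ⟩
  m % q + m / q * q                <⟨ +-monoˡ-< (m / q * q) (m%n<n m q) ⟩
  q + m / q * q                    ≡⟨ cong (q +_) (*-comm (m / q) q) ⟩
  q + q * (m / q)                  ≤⟨ +-monoʳ-≤ q (*-monoʳ-≤ q (m≤n+m∸n (m / q) h)) ⟩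
  q + q * (h + (m / q ∸ h))        ≡⟨ cong (q +_) (*-distribˡ-+ q h (m / q ∸ h)) ⟩
  q + (q * h + q * (m / q ∸ h))    ≡⟨ +-assoc q (q * h) _ ⟨
  q + q * h + q * (m / q ∸ h)      ≡⟨ cong (_+ q * (m / q ∸ h)) (*-suc q h) ⟨
  q * suc h + q * (m / q ∸ h)      ∎
  where open ≤-Reasoning

corollary3 : (q : ℕ) → (pq : Prime q) → ¬ (2 ∣ q) →
    (h : ℕ) → 1 ≤ h → h < q ∸ 1 →
    ¬ InImageZ (2 ^ q) (((2 ^ (q * (q ∸ 1)) ∸ 1) / q) {{prime⇒nonZero pq}} ∸ h)
corollary3 q pq _ h 1≤h h<q-1 = q[1+k]<2^n≤n+qk⇒¬InImageZ q n k below above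
  where
  instance _ = prime⇒nonZero pq
  n = q * (q ∸ 1)
  k = (2 ^ n ∸ 1) / q ∸ h

  1+[2^n∸1]≡2^n : suc (2 ^ n ∸ 1) ≡ 2 ^ n
  1+[2^n∸1]≡2^n = m+[n∸m]≡n (m^n>0 2 n)

  q<2^n : q < 2 ^ n
  q<2^n = ≤-<-trans (m≤m*n q (q ∸ 1) {{>-nonZero (≤-trans 1≤h (<⇒≤ h<q-1))}}) (n<2^n n)

  below : q * suc k < 2 ^ n
  below = subst (q * suc k <_) 1+[2^n∸1]≡2^n (s≤s (q*[1+m/q∸h]≤m (2 ^ n ∸ 1) q h 1≤h (∸-monoˡ-≤ 1 q<2^n)))

  above : 2 ^ n ≤ n + q * k
  above = subst (_≤ n + q * k) 1+[2^n∸1]≡2^n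
    (≤-trans (m<q*[1+h]+q*[m/q∸h] (2 ^ n ∸ 1) q h) (+-monoˡ-≤ (q * k) (*-monoʳ-≤ q h<q-1)))
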